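{- Let $R$ be a commutative ring of characteristic $p$ and $r\ge0$ an even integer. If $r<p$, then $\lambda_r$ spans $V_r(R)^{\Gamma_\infty}$. If $p\le r<2p$, then $\lambda_r$ and $\lambda_{p-1}$ span $V_r(R)^{\Gamma_\infty}$.
   Context: $W_r(R)$ is the $R$-module of homogeneous polynomials of degree $r$ in $R[X,Y]$, with right action of integer matrices of positive determinant $(F|\sigma)(X,Y)=F((X,Y)\sigma')$, where $\left(\begin{smallmatrix}a&b\\c&d\end{smallmatrix}\right)'=\left(\begin{smallmatrix}d&-b\\-c&a\end{smallmatrix}\right)$. $V_r(R)=\mathrm{Hom}_R(W_r(R),R)$ with right action $(\lambda|\sigma)(F)=\lambda(F|\sigma')$. $\{\lambda_i\}_{i=0}^r\subset V_r(R)$ is the basis dual to $\{(-1)^iX^{r-i}Y^i\}_{i=0}^r$. $\Gamma_\infty$ is the stabilizer of the cusp $\infty$ in $SL_2(\mathbb{Z})$, i.e. the matrices $\pm\left(\begin{smallmatrix}1&n\\0&1\end{smallmatrix}\right)$, $n\in\mathbb{Z}$; "spans" means generates as an $R$-module. -}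

module Defs where

open import Level using (Level; _⊔_)
open import Algebra.Bundles using (CommutativeRing)
open import Data.Nat as ℕ using (ℕ; zero; suc; _<_)
open import Data.Integer as ℤ using (ℤ; +_; -[1+_])
open import Data.Fin as Fin using (Fin; toℕ)
open import Data.Vec.Functional using (Vector)
open import Data.Product using (Σ; ∃; _×_; _,_)
open import Data.Sum using (_⊎_)
open import Relation.Binary.PropositionalEquality using (_≡_)
open import Relation.Nullary using (¬_)
import Algebra.Properties.Monoid.Sum as MonoidSum
import Algebra.Definitions.RawMonoid as RawMonoidDefs

record Mat : Set where
  constructor mat
  field a b c d : ℤ

_′ : Mat → Mat
mat a b c d ′ = mat d (ℤ.- b) (ℤ.- c) a

T : ℤ → Mat
T n = mat (+ 1) n (+ 0) (+ 1)

negT : ℤ → Mat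
negT n = mat (ℤ.- + 1) (ℤ.- n) (+ 0) (ℤ.- + 1)

InΓ∞ : Mat → Set
InΓ∞ σ = ∃ λ (n : ℤ) → (σ ≡ T n) ⊎ (σ ≡ negT n)

module _ {c ℓ : Level} (R : CommutativeRing c ℓ) where
  open CommutativeRing R hiding (zero)
  open MonoidSum +-monoid using (sum)
  open RawMonoidDefs +-rawMonoid using () renaming (_×_ to _·1×_)

  HasChar : ℕ → Set ℓ
  HasChar p = (p ·1× 1#) ≈ 0# × (∀ n → 0 < n → n < p → ¬ ((n ·1× 1#) ≈ 0#))

  ι : ℤ → Carrier
  ι (+ n) = n ·1× 1#
  ι -[1+ n ] = - (suc n ·1× 1#)

  -- W_r(R): homogeneous polynomials of degree r, F = Σ_i F i · X^{r-i} Y^i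
  W : ℕ → Set c
  W r = Vector Carrier (suc r)

  -- coefficient sequences (index i = coefficient of X^{m-i} Y^i in degree m)
  Coeffs : Set c
  Coeffs = ℕ → Carrier

  one : Coeffs
  one zero = 1#
  one (suc _) = 0#

  -- multiplication by the linear form αX + βY
  mulLin : Carrier → Carrier → Coeffs → Coeffs
  mulLin α β g zero = α * g zero
  mulLin α β g (suc i) = α * g (suc i) + β * g i

  mulLinPow : ℕ → Carrier → Carrier → Coeffs → Coeffs
  mulLinPow zero α β g = g
  mulLinPow (suc k) α β g = mulLin α β (mulLinPow k α β g)

  -- F(αX + βY, γX + δY) = Σ_j F j (αX+βY)^{r-j} (γX+δY)^j
  subst : (r : ℕ) → W r → Carrier → Carrier → Carrier → Carrier → W r
  subst r F α β γ δ i =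
    sum (λ (j : Fin (suc r)) →
      F j * mulLinPow (r ℕ.∸ toℕ j) α β (mulLinPow (toℕ j) γ δ one) (toℕ i))

  -- (F|σ)(X,Y) = F((X,Y)σ') = F(dX - cY, -bX + aY)
  _∣W_ : {r : ℕ} → W r → Mat → W r
  _∣W_ {r} F (mat a b c d) = subst r F (ι d) (- ι c) (- ι b) (ι a)

  record V (r : ℕ) : Set (c ⊔ ℓ) where
    field
      fn : W r → Carrier
      fn-cong : ∀ {F G : W r} → (∀ i → F i ≈ G i) → fn F ≈ fn G
      fn-+ : ∀ (F G : W r) → fn (λ i → F i + G i) ≈ fn F + fn G
      fn-* : ∀ (x : Carrier) (F : W r) → fn (λ i → x * F i) ≈ x * fn F

  -- (λ|σ)(F) = λ(F|σ'), so λ ∈ V_r^{Γ∞} iff λ(F|σ') = λ(F)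
  -- λ ∈ V_r(R)^{Γ∞}
  -- a functional f on W_r is Γ∞-invariant: f(F|σ') = f(F) for all σ ∈ Γ∞
  InvariantFn : {r : ℕ} → (W r → Carrier) → Set (c ⊔ ℓ)
  InvariantFn {r} f = ∀ (σ : Mat) → InΓ∞ σ → ∀ (F : W r) → f (F ∣W (σ ′)) ≈ f F

  Invariant : {r : ℕ} → V r → Set (c ⊔ ℓ)
  Invariant l = InvariantFn (V.fn l)

  coeff : {r : ℕ} → W r → ℕ → Carrier
  coeff {r} F i with i ℕ.<? suc r
  ... | Relation.Nullary.yes i<r = F (Fin.fromℕ< i<r)
  ... | Relation.Nullary.no _ = 0#

  sgn : ℕ → Carrier
  sgn zero = 1#
  sgn (suc i) = - sgn i

  -- λ_i : dual basis to (-1)^i X^{r-i} Y^i, i.e. λ_i(F) = (-1)^i · (coefficient of X^{r-i}Y^i)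
  lam : (r i : ℕ) → W r → Carrier
  lam r i F = sgn i * coeff F i

{-# OPTIONS --safe #-}

-- A functional l on W_r is determined by the values D m = l(X^(r-m) Y^m). Invariance under T 1,
-- which acts by F(X, Y) ↦ F(X, X + Y), gives Σ_{i ≤ m} C(m, i) D i = D m for every m ≤ r. Read at
-- m + 1 ≤ r, this is (m + 1) D m + Σ_{i < m} C(m + 1, i) D i = 0, so by induction D m = 0 for all
-- m < r except m = p - 1: for the other m, m + 1 is prime to p as m + 1 ≠ p and m + 1 < 2p, and the
-- index p - 1 drops out of the later equations because p divides C(j, p - 1) for p ≤ j ≤ 2p - 2
-- (r even and r < 2p give r ≤ 2p - 2). Hence l is a combination of λ_r and λ_{p-1}.
-- Conversely, ± T n acts on the coefficient of X^(r-k) Y^k through the column (C(j, k))_{j ≤ r} of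
-- Pascal's triangle and the sign (±1)^r = 1, so λ_k is invariant as soon as this column reduces to
-- a unit vector in R, which is the case for k = r and, by the same divisibility, for k = p - 1.
module Submission where

open import Defs
open import Level using (Level)
open import Algebra.Bundles using (CommutativeRing)
open import Data.Nat.Base as ℕ using (ℕ; zero; suc; _∸_; _<_; _≤_; s≤s; z≤n)
import Data.Nat.Properties as ℕ
open import Data.Nat.Combinatorics using (_C_; nCn≡1; nCk+nC[k+1]≡[n+1]C[k+1]; k>n⇒nCk≡0)
open import Data.Nat.Divisibility using (_∣_; divides; n∣m*n)
open import Data.Nat.Primality using (Prime; ¬prime[0])
open import Data.Nat.Coprimality using (Coprime; coprime-Bézout)
open import Data.Nat.GCD using (module Bézout)
open import Data.Nat.Induction using (<-rec)
import Data.Integer.Base as ℤ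
open import Data.Fin.Base as Fin using (Fin; toℕ; fromℕ<; punchIn; punchOut)
open import Data.Fin.Properties
  using (toℕ<n; toℕ-injective; toℕ-fromℕ<; punchInᵢ≢i; punchIn-injective; punchIn-punchOut)
open import Data.Vec.Functional using (Vector; removeAt)
open import Data.Product.Base using (Σ; _,_)
open import Data.Sum.Base using (_⊎_; inj₁; inj₂)
open import Function.Base using (_∘_)
open import Relation.Binary.Definitions using (tri<; tri≈; tri>)
open import Relation.Nullary using (¬_; yes; no; contradiction)
open import Relation.Binary.PropositionalEquality as ≡ using (_≡_; _≢_; refl; cong; cong₂)

module Binomial where
  open import Data.Nat.Base
  open import Data.Nat.Properties
  open import Data.Nat.Combinatorics
  open import Data.Nat.Divisibility
  open import Data.Nat.Primality
  open ≡ using (sym; trans; module ≡-Reasoning)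

  [1+n]Cn≡1+n : ∀ n → suc n C n ≡ suc n
  [1+n]Cn≡1+n n = begin
    suc n C n            ≡⟨ nCk≡nC[n∸k] (n≤1+n n) ⟩
    suc n C (1 + n ∸ n)  ≡⟨ cong (suc n C_) (m+n∸n≡m 1 n) ⟩
    suc n C 1            ≡⟨ nC1≡n (suc n) ⟩
    suc n                ∎
    where open ≡-Reasoning

  [1+k]*[1+n]C[1+k]≡[1+n]*nCk : ∀ n k → suc k * (suc n C suc k) ≡ suc n * (n C k)
  [1+k]*[1+n]C[1+k]≡[1+n]*nCk zero    zero    = refl
  [1+k]*[1+n]C[1+k]≡[1+n]*nCk zero    (suc k) = *-zeroʳ (2 + k)
  [1+k]*[1+n]C[1+k]≡[1+n]*nCk (suc n) zero    = begin
    1 * ((2 + n) C 1)  ≡⟨ *-identityˡ _ ⟩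
    (2 + n) C 1        ≡⟨ nC1≡n (2 + n) ⟩
    2 + n              ≡⟨ *-identityʳ (2 + n) ⟨
    (2 + n) * 1        ∎
    where open ≡-Reasoning
  [1+k]*[1+n]C[1+k]≡[1+n]*nCk (suc n) (suc k) = begin
    (2 + k) * ((2 + n) C (2 + k))    ≡⟨ cong ((2 + k) *_) (nCk+nC[k+1]≡[n+1]C[k+1] (suc n) (suc k)) ⟨
    (2 + k) * (a + b)                ≡⟨ *-distribˡ-+ (2 + k) a b ⟩
    (a + (1 + k) * a) + (2 + k) * b  ≡⟨ +-assoc a _ _ ⟩
    a + ((1 + k) * a + (2 + k) * b)  ≡⟨ cong₂ (λ u v → a + (u + v)) ([1+k]*[1+n]C[1+k]≡[1+n]*nCk n k)
                                                                 ([1+k]*[1+n]C[1+k]≡[1+n]*nCk n (suc k)) ⟩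
    a + ((1 + n) * c + (1 + n) * d)  ≡⟨ cong (a +_) (*-distribˡ-+ (1 + n) c d) ⟨
    a + (1 + n) * (c + d)            ≡⟨ cong (λ t → a + (1 + n) * t) (nCk+nC[k+1]≡[n+1]C[k+1] n k) ⟩
    (2 + n) * a                      ∎
    where
    open ≡-Reasoning
    a b c d : ℕ
    a = suc n C suc k
    b = suc n C suc (suc k)
    c = n C k
    d = n C suc k

  p∣pC[1+k] : ∀ {p k} → Prime p → suc k < p → p ∣ p C suc k
  p∣pC[1+k] {suc n} {k} p-prime 1+k<p
    with euclidsLemma (suc k) (suc n C suc k) p-prime
           (divides (n C k) (trans ([1+k]*[1+n]C[1+k]≡[1+n]*nCk n k) (*-comm (suc n) (n C k))))
  ... | inj₁ p∣1+k = contradiction (∣⇒≤ p∣1+k) (<⇒≱ 1+k<p)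
  ... | inj₂ p∣C   = p∣C

  p∣[p+k]Cm : ∀ {p k m} → Prime p → k < m → m < p → p ∣ (p + k) C m
  p∣[p+k]Cm {p} {zero}  {suc m} p-prime _ m<p =
    ≡.subst (λ n → p ∣ n C suc m) (sym (+-identityʳ p)) (p∣pC[1+k] p-prime m<p)
  p∣[p+k]Cm {p} {suc k} {suc m} p-prime (s≤s k<m) 1+m<p =
    ≡.subst (p ∣_) pascal
      (∣m∣n⇒∣m+n (p∣[p+k]Cm p-prime k<m (<-trans (n<1+n m) 1+m<p))
                 (p∣[p+k]Cm p-prime (m<n⇒m<1+n k<m) 1+m<p))
    where
    pascal : (p + k) C m + (p + k) C suc m ≡ (p + suc k) C suc m
    pascal = trans (nCk+nC[k+1]≡[n+1]C[k+1] (p + k) m) (cong (_C suc m) (sym (+-suc p k)))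

  p∣nC[p-1] : ∀ {p′ n} → Prime (suc p′) → p′ < n → n ≤ 2 * p′ → suc p′ ∣ n C p′
  p∣nC[p-1] {p′} {n} p-prime p′<n n≤2p′ =
    ≡.subst (λ t → suc p′ ∣ t C p′) (m+[n∸m]≡n p′<n) (p∣[p+k]Cm p-prime k<p′ (n<1+n p′))
    where
    k : ℕ
    k = n ∸ suc p′
    k<p′ : k < p′
    k<p′ = +-cancelˡ-< p′ k p′ (begin-strict
      p′ + k      <⟨ n<1+n (p′ + k) ⟩
      suc p′ + k  ≡⟨ m+[n∸m]≡n p′<n ⟩
      n           ≤⟨ n≤2p′ ⟩
      2 * p′      ≡⟨ cong (p′ +_) (+-identityʳ p′) ⟩
      p′ + p′     ∎)
      where open ≤-Reasoning

  p∣n<2p⇒n≡p : ∀ {p n} → p ∣ n → 0 < n → n < 2 * p → n ≡ p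
  p∣n<2p⇒n≡p     (divides 0 refl)             ()  _
  p∣n<2p⇒n≡p {p} (divides 1 refl)             _   _    = +-identityʳ p
  p∣n<2p⇒n≡p {p} (divides (suc (suc q)) refl) _   n<2p =
    contradiction n<2p (≤⇒≯ (+-monoʳ-≤ p (+-monoʳ-≤ p z≤n)))

  even<2[1+p]⇒≤2p : ∀ {p r} → 2 ∣ r → r < 2 * suc p → r ≤ 2 * p
  even<2[1+p]⇒≤2p {p} (divides q refl) q*2<2[1+p] =
    ≡.subst (_≤ 2 * p) (*-comm 2 q) (*-monoʳ-≤ 2 (≤-pred q<1+p))
    where
    q<1+p : q < suc p
    q<1+p = *-cancelˡ-< 2 q (suc p) (≡.subst (_< 2 * suc p) (*-comm q 2) q*2<2[1+p])

  prime∧∤⇒coprime : ∀ {p n} → Prime p → ¬ p ∣ n → Coprime p n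
  prime∧∤⇒coprime p-prime p∤n (d∣p , d∣n) with prime⇒irreducible p-prime d∣p
  ... | inj₁ d≡1  = d≡1
  ... | inj₂ refl = contradiction d∣n p∤n

open Binomial

toℕ≡⇒≡fromℕ< : ∀ {n k} {j : Fin n} .(k<n : k < n) → toℕ j ≡ k → j ≡ fromℕ< k<n
toℕ≡⇒≡fromℕ< k<n eq = toℕ-injective (≡.trans eq (≡.sym (toℕ-fromℕ< k<n)))

module _ {c ℓ : Level} (R : CommutativeRing c ℓ) where
  open CommutativeRing R hiding (zero) renaming (refl to ≈-refl; reflexive to ≈-reflexive)
  open import Algebra.Properties.Ring ring
    using (-0#≈0#; -‿involutive; -‿distribˡ-*; -‿distribʳ-*; +-identityˡ-unique)
  open import Algebra.Properties.Semiring.Mult semiring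
    using (_×_; ×-homo-1; ×-congʳ; ×-congˡ; ×-assoc-*; ×-assocˡ; ×-comm-*; ×-homo-+)
  open import Algebra.Properties.Semiring.Exp semiring using (_^_; ^-congˡ; ^-homo-*)
  open import Algebra.Properties.Semiring.Sum semiring
    using (sum; sum-cong-≋; sum-remove; sum-replicate-zero)
  open import Algebra.Properties.CommutativeSemigroup *-commutativeSemigroup
    using (x∙yz≈y∙xz; interchange)
  open import Relation.Binary.Reasoning.Setoid setoid

  [n×1]*x≈n×x : ∀ n x → (n × 1#) * x ≈ n × x
  [n×1]*x≈n×x n x = trans (×-assoc-* n 1# x) (×-congʳ n (*-identityˡ x))

  n×1≈0⇒n×x≈0 : ∀ n {x} → n × 1# ≈ 0# → n × x ≈ 0#
  n×1≈0⇒n×x≈0 n {x} n×1≈0 = trans (sym ([n×1]*x≈n×x n x)) (trans (*-congʳ n×1≈0) (zeroˡ x))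

  n×0≈0 : ∀ n → n × 0# ≈ 0#
  n×0≈0 zero    = ≈-refl
  n×0≈0 (suc n) = trans (+-identityˡ _) (n×0≈0 n)

  n×x≈0⇒[m*n]×x≈0 : ∀ m n {x} → n × x ≈ 0# → (m ℕ.* n) × x ≈ 0#
  n×x≈0⇒[m*n]×x≈0 m n {x} n×x≈0 = trans (sym (×-assocˡ x m n)) (trans (×-congʳ m n×x≈0) (n×0≈0 m))

  n×x≈0⇒[1+n]×x≈x : ∀ n {x} → n × x ≈ 0# → suc n × x ≈ x
  n×x≈0⇒[1+n]×x≈x n {x} n×x≈0 = trans (+-congˡ n×x≈0) (+-identityʳ x)

  1^n≈1 : ∀ n → 1# ^ n ≈ 1#
  1^n≈1 zero    = ≈-refl
  1^n≈1 (suc n) = trans (*-identityˡ _) (1^n≈1 n)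

  ^-even : ∀ {ε} → ε * ε ≈ 1# → ∀ {n} → 2 ∣ n → ε ^ n ≈ 1#
  ^-even {ε} ε²≈1 (divides q refl) = ε^[2q]≈1 q
    where
    ε^[2q]≈1 : ∀ q → ε ^ (q ℕ.* 2) ≈ 1#
    ε^[2q]≈1 zero    = ≈-refl
    ε^[2q]≈1 (suc q) = begin
      ε * (ε * ε ^ (q ℕ.* 2))  ≈⟨ *-assoc ε ε _ ⟨
      ε * ε * ε ^ (q ℕ.* 2)    ≈⟨ *-cong ε²≈1 (ε^[2q]≈1 q) ⟩
      1# * 1#                  ≈⟨ *-identityˡ 1# ⟩
      1#                       ∎

  -x*-x≈x*x : ∀ x → - x * - x ≈ x * x
  -x*-x≈x*x x = begin
    - x * - x    ≈⟨ -‿distribˡ-* x (- x) ⟨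
    - (x * - x)  ≈⟨ -‿cong (-‿distribʳ-* x x) ⟨
    - - (x * x)  ≈⟨ -‿involutive (x * x) ⟩
    x * x        ∎

  sgn*sgn≈1 : ∀ n → sgn R n * sgn R n ≈ 1#
  sgn*sgn≈1 zero    = *-identityˡ 1#
  sgn*sgn≈1 (suc n) = trans (-x*-x≈x*x (sgn R n)) (sgn*sgn≈1 n)

  sum-zero : ∀ {n} (f : Vector Carrier n) → (∀ j → f j ≈ 0#) → sum f ≈ 0#
  sum-zero {n} f f≈0 = trans (sum-cong-≋ f≈0) (sum-replicate-zero n)

  sum-single : ∀ {n} (f : Vector Carrier (suc n)) a → (∀ j → j ≢ a → f j ≈ 0#) → sum f ≈ f a
  sum-single f a off = begin
    sum f                     ≈⟨ sum-remove {i = a} f ⟩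
    f a + sum (removeAt f a)  ≈⟨ +-congˡ (sum-zero _ (λ j → off (punchIn a j) (punchInᵢ≢i a j))) ⟩
    f a + 0#                  ≈⟨ +-identityʳ (f a) ⟩
    f a                       ∎

  sum-pair : ∀ {n} (f : Vector Carrier (suc n)) {a b} → a ≢ b →
             (∀ j → j ≢ a → j ≢ b → f j ≈ 0#) → sum f ≈ f a + f b
  sum-pair {zero}  f {Fin.zero} {Fin.zero} a≢b off = contradiction refl a≢b
  sum-pair {suc n} f {a} {b} a≢b off = begin
    sum f                     ≈⟨ sum-remove {i = a} f ⟩
    f a + sum (removeAt f a)  ≈⟨ +-congˡ (sum-single (removeAt f a) b′ off′) ⟩
    f a + f (punchIn a b′)    ≡⟨ cong (λ j → f a + f j) (punchIn-punchOut a≢b) ⟩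
    f a + f b                 ∎
    where
    b′ : Fin (suc n)
    b′ = punchOut a≢b
    off′ : ∀ j → j ≢ b′ → f (punchIn a j) ≈ 0#
    off′ j j≢b′ = off (punchIn a j) (punchInᵢ≢i a j)
      (λ eq → j≢b′ (punchIn-injective a j b′ (≡.trans eq (≡.sym (punchIn-punchOut a≢b)))))

  coeff-fromℕ< : ∀ {r k} (F : W R r) (k<1+r : k < suc r) → coeff R F k ≡ F (fromℕ< k<1+r)
  coeff-fromℕ< {r} {k} F k<1+r with k ℕ.<? suc r
  ... | yes _     = refl
  ... | no  k≮1+r = contradiction k<1+r k≮1+r

  lam-fromℕ< : ∀ {r k} (F : W R r) (k<1+r : k < suc r) → lam R r k F ≡ sgn R k * F (fromℕ< k<1+r)
  lam-fromℕ< {k = k} F k<1+r = cong (sgn R k *_) (coeff-fromℕ< F k<1+r)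

  basis : ∀ {r} → ℕ → W R r
  basis m j with toℕ j ℕ.≟ m
  ... | yes _ = 1#
  ... | no  _ = 0#

  basis-≡ : ∀ {r} m (j : Fin (suc r)) → toℕ j ≡ m → basis m j ≈ 1#
  basis-≡ m j j≡m with toℕ j ℕ.≟ m
  ... | yes _   = ≈-refl
  ... | no  j≢m = contradiction j≡m j≢m

  basis-≢ : ∀ {r} m (j : Fin (suc r)) → toℕ j ≢ m → basis m j ≈ 0#
  basis-≢ m j j≢m with toℕ j ℕ.≟ m
  ... | yes j≡m = contradiction j≡m j≢m
  ... | no  _   = ≈-refl

  onBasis : ∀ {r} → V R r → ℕ → Carrier
  onBasis l m = V.fn l (basis m)

  module _ {r} (l : V R r) where
    open V l

    fn-0 : fn (λ _ → 0#) ≈ 0#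
    fn-0 = begin
      fn (λ _ → 0#)       ≈⟨ fn-cong (λ _ → sym (zeroˡ 0#)) ⟩
      fn (λ _ → 0# * 0#)  ≈⟨ fn-* 0# (λ _ → 0#) ⟩
      0# * fn (λ _ → 0#)  ≈⟨ zeroˡ _ ⟩
      0#                  ∎

    fn-sum : ∀ {n} (H : Fin n → W R r) → fn (λ j → sum (λ k → H k j)) ≈ sum (λ k → fn (H k))
    fn-sum {zero}  H = fn-0
    fn-sum {suc n} H = trans (fn-+ (H Fin.zero) (λ j → sum (λ k → H (Fin.suc k) j)))
                             (+-congˡ (fn-sum (H ∘ Fin.suc)))

    fn-expand : ∀ G → fn G ≈ sum (λ k → G k * onBasis l (toℕ k))
    fn-expand G = begin
      fn G                                          ≈⟨ fn-cong (λ j → sym (G≈sum j)) ⟩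
      fn (λ j → sum (λ k → G k * basis (toℕ k) j))  ≈⟨ fn-sum (λ k j → G k * basis (toℕ k) j) ⟩
      sum (λ k → fn (λ j → G k * basis (toℕ k) j))  ≈⟨ sum-cong-≋ (λ k → fn-* (G k) (basis (toℕ k))) ⟩
      sum (λ k → G k * onBasis l (toℕ k))           ∎
      where
      G≈sum : ∀ j → sum (λ k → G k * basis (toℕ k) j) ≈ G j
      G≈sum j = begin
        sum (λ k → G k * basis (toℕ k) j)  ≈⟨ sum-single _ j off ⟩
        G j * basis (toℕ j) j              ≈⟨ *-congˡ (basis-≡ _ j refl) ⟩
        G j * 1#                           ≈⟨ *-identityʳ (G j) ⟩
        G j                                ∎
        where
        off : ∀ k → k ≢ j → G k * basis (toℕ k) j ≈ 0#
        off k k≢j = trans (*-congˡ (basis-≢ _ j (k≢j ∘ ≡.sym ∘ toℕ-injective))) (zeroʳ (G k))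

  mulLinPow-β≈0 : ∀ {α β} → β ≈ 0# → ∀ k g i → mulLinPow R k α β g i ≈ α ^ k * g i
  mulLinPow-β≈0 β≈0 zero    g i    = sym (*-identityˡ (g i))
  mulLinPow-β≈0 β≈0 (suc k) g zero =
    trans (*-congˡ (mulLinPow-β≈0 β≈0 k g zero)) (sym (*-assoc _ _ _))
  mulLinPow-β≈0 {α} {β} β≈0 (suc k) g (suc i) = begin
    α * mulLinPow R k α β g (suc i) + β * mulLinPow R k α β g i
      ≈⟨ +-cong (*-congˡ (mulLinPow-β≈0 β≈0 k g (suc i))) (trans (*-congʳ β≈0) (zeroˡ _)) ⟩
    α * (α ^ k * g (suc i)) + 0#  ≈⟨ +-identityʳ _ ⟩
    α * (α ^ k * g (suc i))       ≈⟨ *-assoc α _ _ ⟨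
    α ^ suc k * g (suc i)         ∎

  mulLinPow-one : ∀ γ δ j i → mulLinPow R j γ δ (one R) i ≈ (j C i) × (γ ^ (j ∸ i) * δ ^ i)
  mulLinPow-one γ δ zero    zero    = sym (trans (×-homo-1 _) (*-identityˡ 1#))
  mulLinPow-one γ δ zero    (suc i) = ≈-refl
  mulLinPow-one γ δ (suc j) zero    = begin
    γ * mulLinPow R j γ δ (one R) zero  ≈⟨ *-congˡ (trans (mulLinPow-one γ δ j zero) (×-homo-1 _)) ⟩
    γ * (γ ^ j * 1#)                    ≈⟨ *-assoc γ _ _ ⟨
    γ ^ suc j * 1#                      ≈⟨ ×-homo-1 _ ⟨
    1 × (γ ^ suc j * 1#)                ∎
  mulLinPow-one γ δ (suc j) (suc i) = begin
    γ * mulLinPow R j γ δ (one R) (suc i) + δ * mulLinPow R j γ δ (one R) i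
      ≈⟨ +-cong (*-congˡ (mulLinPow-one γ δ j (suc i))) (*-congˡ (mulLinPow-one γ δ j i)) ⟩
    γ * ((j C suc i) × (γ ^ (j ∸ suc i) * δ ^ suc i)) + δ * ((j C i) × (γ ^ (j ∸ i) * δ ^ i))
      ≈⟨ +-cong (×-comm-* (j C suc i) γ _) (×-comm-* (j C i) δ _) ⟩
    (j C suc i) × (γ * (γ ^ (j ∸ suc i) * δ ^ suc i)) + (j C i) × (δ * (γ ^ (j ∸ i) * δ ^ i))
      ≈⟨ +-cong γ-step (×-congʳ (j C i) (x∙yz≈y∙xz δ _ _)) ⟩
    (j C suc i) × x + (j C i) × x
      ≈⟨ +-comm _ _ ⟩
    (j C i) × x + (j C suc i) × x
      ≈⟨ ×-homo-+ x (j C i) (j C suc i) ⟨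
    (j C i ℕ.+ j C suc i) × x
      ≡⟨ cong (_× x) (nCk+nC[k+1]≡[n+1]C[k+1] j i) ⟩
    (suc j C suc i) × x ∎
    where
    x : Carrier
    x = γ ^ (j ∸ i) * δ ^ suc i
    γ-step : (j C suc i) × (γ * (γ ^ (j ∸ suc i) * δ ^ suc i)) ≈ (j C suc i) × x
    γ-step with suc i ℕ.≤? j
    ... | yes i<j = ×-congʳ (j C suc i) (begin
          γ * (γ ^ (j ∸ suc i) * δ ^ suc i)  ≈⟨ *-assoc γ _ _ ⟨
          γ ^ suc (j ∸ suc i) * δ ^ suc i    ≡⟨ cong (λ e → γ ^ e * δ ^ suc i) (ℕ.+-∸-assoc 1 i<j) ⟨
          x                                  ∎)
    ... | no  i≮j = trans (×-congˡ C≡0) (sym (×-congˡ C≡0))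
      where
      C≡0 : j C suc i ≡ 0
      C≡0 = k>n⇒nCk≡0 (ℕ.≰⇒> i≮j)

  subst-β≈0 : ∀ {r α β γ δ} → β ≈ 0# → ∀ (F : W R r) i →
    subst R r F α β γ δ i ≈
      sum (λ j → F j * (α ^ (r ∸ toℕ j) * ((toℕ j C toℕ i) × (γ ^ (toℕ j ∸ toℕ i) * δ ^ toℕ i))))
  subst-β≈0 {r} {α} {γ = γ} {δ} β≈0 F i = sum-cong-≋ {suc r} λ j →
    *-congˡ {F j} (trans (mulLinPow-β≈0 {α} β≈0 (r ∸ toℕ j) (mulLinPow R (toℕ j) γ δ (one R)) (toℕ i))
                         (*-congˡ (mulLinPow-one γ δ (toℕ j) (toℕ i))))

  subst-fixes-coeff : ∀ {r α β γ δ ε} → 2 ∣ r → β ≈ 0# → α ≈ ε → δ ≈ ε → ε * ε ≈ 1# →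
    (k : Fin (suc r)) → (∀ j → j ≢ k → (toℕ j C toℕ k) × 1# ≈ 0#) →
    ∀ F → subst R r F α β γ δ k ≈ F k
  subst-fixes-coeff {r} {α} {β} {γ} {δ} {ε} 2∣r β≈0 α≈ε δ≈ε ε²≈1 k C≈0 F = begin
    subst R r F α β γ δ k  ≈⟨ subst-β≈0 β≈0 F k ⟩
    sum (λ j → F j * t j)  ≈⟨ sum-single _ k (λ j j≢k → trans (*-congˡ (t≈0 j j≢k)) (zeroʳ (F j))) ⟩
    F k * t k              ≈⟨ *-congˡ tk≈1 ⟩
    F k * 1#               ≈⟨ *-identityʳ (F k) ⟩
    F k                    ∎
    where
    t : Fin (suc r) → Carrier
    t j = α ^ (r ∸ toℕ j) * ((toℕ j C toℕ k) × (γ ^ (toℕ j ∸ toℕ k) * δ ^ toℕ k))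
    t≈0 : ∀ j → j ≢ k → t j ≈ 0#
    t≈0 j j≢k = trans (*-congˡ (n×1≈0⇒n×x≈0 (toℕ j C toℕ k) (C≈0 j j≢k))) (zeroʳ _)
    tk≈1 : t k ≈ 1#
    tk≈1 = begin
      α ^ (r ∸ toℕ k) * ((toℕ k C toℕ k) × (γ ^ (toℕ k ∸ toℕ k) * δ ^ toℕ k))
        ≡⟨ cong₂ (λ a b → α ^ (r ∸ toℕ k) * (a × (γ ^ b * δ ^ toℕ k)))
                 (nCn≡1 (toℕ k)) (ℕ.n∸n≡0 (toℕ k)) ⟩
      α ^ (r ∸ toℕ k) * (1 × (1# * δ ^ toℕ k))
        ≈⟨ *-congˡ (trans (×-homo-1 _) (*-identityˡ _)) ⟩
      α ^ (r ∸ toℕ k) * δ ^ toℕ k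
        ≈⟨ *-cong (^-congˡ (r ∸ toℕ k) α≈ε) (^-congˡ (toℕ k) δ≈ε) ⟩
      ε ^ (r ∸ toℕ k) * ε ^ toℕ k
        ≈⟨ ^-homo-* ε (r ∸ toℕ k) (toℕ k) ⟨
      ε ^ (r ∸ toℕ k ℕ.+ toℕ k)
        ≡⟨ cong (ε ^_) (ℕ.m∸n+n≡m (ℕ.≤-pred (toℕ<n k))) ⟩
      ε ^ r
        ≈⟨ ^-even ε²≈1 2∣r ⟩
      1# ∎

  UnitPascalColumn : ℕ → ℕ → Set ℓ
  UnitPascalColumn r k = ∀ j → j ≤ r → j ≢ k → (j C k) × 1# ≈ 0#

  unitPascalColumn-r : ∀ r → UnitPascalColumn r r
  unitPascalColumn-r r j j≤r j≢r = ≈-reflexive (cong (_× 1#) (k>n⇒nCk≡0 (ℕ.≤∧≢⇒< j≤r j≢r)))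

  lam-invariant : ∀ {r k} → 2 ∣ r → k ≤ r → UnitPascalColumn r k → InvariantFn R (lam R r k)
  lam-invariant {r} {k} 2∣r k≤r unit σ (n , σ≡±T) F = begin
    lam R r k (_∣W_ R F (σ ′))  ≡⟨ lam-fromℕ< (_∣W_ R F (σ ′)) (s≤s k≤r) ⟩
    sgn R k * _∣W_ R F (σ ′) K  ≈⟨ *-congˡ (fixes σ≡±T) ⟩
    sgn R k * F K               ≡⟨ lam-fromℕ< F (s≤s k≤r) ⟨
    lam R r k F                 ∎
    where
    K : Fin (suc r)
    K = fromℕ< (s≤s k≤r)
    unit′ : ∀ j → j ≢ K → (toℕ j C toℕ K) × 1# ≈ 0#
    unit′ j j≢K rewrite toℕ-fromℕ< (s≤s k≤r) =
      unit (toℕ j) (ℕ.≤-pred (toℕ<n j)) (j≢K ∘ toℕ≡⇒≡fromℕ< (s≤s k≤r))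
    -- F ∣W (± T n) ′ is F(εX, γX + εY) with ε = ±1.
    fixes : ∀ {σ} → σ ≡ T n ⊎ σ ≡ negT n → _∣W_ R F (σ ′) K ≈ F K
    fixes (inj₁ refl) =
      subst-fixes-coeff 2∣r -0#≈0# (×-homo-1 1#) (×-homo-1 1#) (*-identityˡ 1#) K unit′ F
    fixes (inj₂ refl) =
      subst-fixes-coeff 2∣r -0#≈0# (-‿cong (×-homo-1 1#)) (-‿cong (×-homo-1 1#))
                        (trans (-x*-x≈x*x 1#) (*-identityˡ 1#)) K unit′ F

  subst-basis : ∀ {r α β γ δ m} → β ≈ 0# → m ≤ r → ∀ i →
    subst R r (basis m) α β γ δ i ≈ α ^ (r ∸ m) * ((m C toℕ i) × (γ ^ (m ∸ toℕ i) * δ ^ toℕ i))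
  subst-basis {r} {α} {β} {γ} {δ} {m} β≈0 m≤r i = begin
    subst R r (basis m) α β γ δ i      ≈⟨ subst-β≈0 β≈0 (basis m) i ⟩
    sum (λ j → basis m j * t (toℕ j))  ≈⟨ sum-single _ M off ⟩
    basis m M * t (toℕ M)              ≈⟨ *-cong (basis-≡ m M toℕ-M) (≈-reflexive (cong t toℕ-M)) ⟩
    1# * t m                           ≈⟨ *-identityˡ (t m) ⟩
    t m                                ∎
    where
    M : Fin (suc r)
    M = fromℕ< (s≤s m≤r)
    toℕ-M : toℕ M ≡ m
    toℕ-M = toℕ-fromℕ< (s≤s m≤r)
    t : ℕ → Carrier
    t j = α ^ (r ∸ j) * ((j C toℕ i) × (γ ^ (j ∸ toℕ i) * δ ^ toℕ i))
    off : ∀ j → j ≢ M → basis m j * t (toℕ j) ≈ 0#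
    off j j≢M = trans (*-congʳ (basis-≢ m j (j≢M ∘ toℕ≡⇒≡fromℕ< (s≤s m≤r)))) (zeroˡ (t (toℕ j)))

  basis-shear : ∀ {r m} → m ≤ r → ∀ i → _∣W_ R (basis m) (T (ℤ.+ 1) ′) i ≈ (m C toℕ i) × 1#
  basis-shear {r} {m} m≤r i = begin
    _∣W_ R (basis m) (T (ℤ.+ 1) ′) i                             ≈⟨ subst-basis -0#≈0# m≤r i ⟩
    α ^ (r ∸ m) * ((m C toℕ i) × (γ ^ (m ∸ toℕ i) * α ^ toℕ i))
      ≈⟨ *-cong (x^n≈1 (r ∸ m) α≈1)
                (×-congʳ (m C toℕ i) (*-cong (x^n≈1 (m ∸ toℕ i) γ≈1) (x^n≈1 (toℕ i) α≈1))) ⟩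
    1# * ((m C toℕ i) × (1# * 1#))                               ≈⟨ *-identityˡ _ ⟩
    (m C toℕ i) × (1# * 1#)                                      ≈⟨ ×-congʳ (m C toℕ i) (*-identityˡ 1#) ⟩
    (m C toℕ i) × 1#                                             ∎
    where
    α γ : Carrier
    α = ι R (ℤ.+ 1)
    γ = - ι R ℤ.-[1+ 0 ]
    α≈1 : α ≈ 1#
    α≈1 = ×-homo-1 1#
    γ≈1 : γ ≈ 1#
    γ≈1 = trans (-‿cong (-‿cong α≈1)) (-‿involutive 1#)
    x^n≈1 : ∀ n {x} → x ≈ 1# → x ^ n ≈ 1#
    x^n≈1 n x≈1 = trans (^-congˡ n x≈1) (1^n≈1 n)

  shear-recurrence : ∀ {r} (l : V R r) → Invariant R l → ∀ m → m ≤ r →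
    sum (λ (i : Fin (suc r)) → ((m C toℕ i) × 1#) * onBasis l (toℕ i)) ≈ onBasis l m
  shear-recurrence {r} l inv m m≤r = begin
    sum (λ i → ((m C toℕ i) × 1#) * D i)
      ≈⟨ sum-cong-≋ (λ i → *-congʳ {D i} (basis-shear m≤r i)) ⟨
    sum (λ i → _∣W_ R (basis m) (T (ℤ.+ 1) ′) i * D i)
      ≈⟨ fn-expand l _ ⟨
    V.fn l (_∣W_ R (basis m) (T (ℤ.+ 1) ′))
      ≈⟨ inv (T (ℤ.+ 1)) (ℤ.+ 1 , inj₁ refl) (basis m) ⟩
    onBasis l m ∎
    where
    D : Fin (suc r) → Carrier
    D i = onBasis l (toℕ i)

  recurrence-vanishing : ∀ {r} (D : ℕ → Carrier) e →
    (∀ m → m ≤ r → sum (λ (i : Fin (suc r)) → ((m C toℕ i) × 1#) * D (toℕ i)) ≈ D m) →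
    (∀ m → m < r → m ≢ e → ∀ {x} → suc m × x ≈ 0# → x ≈ 0#) →
    (∀ m → m < r → e < m → (suc m C e) × 1# ≈ 0#) →
    ∀ m → m < r → m ≢ e → D m ≈ 0#
  recurrence-vanishing {r} D e recurrence cancel C≈0 = <-rec _ step
    where
    step : ∀ m → (∀ {i} → i < m → i < r → i ≢ e → D i ≈ 0#) → m < r → m ≢ e → D m ≈ 0#
    step m ih m<r m≢e = cancel m m<r m≢e (+-identityˡ-unique _ _ two-terms)
      where
      f : Fin (suc r) → Carrier
      f i = ((suc m C toℕ i) × 1#) * D (toℕ i)
      a b : Fin (suc r)
      a = fromℕ< (ℕ.m<n⇒m<1+n m<r)
      b = fromℕ< (s≤s m<r)
      toℕ-a : toℕ a ≡ m
      toℕ-a = toℕ-fromℕ< (ℕ.m<n⇒m<1+n m<r)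
      toℕ-b : toℕ b ≡ suc m
      toℕ-b = toℕ-fromℕ< (s≤s m<r)
      fa : f a ≈ suc m × D m
      fa = begin
        f a                        ≡⟨ cong (λ t → ((suc m C t) × 1#) * D t) toℕ-a ⟩
        ((suc m C m) × 1#) * D m   ≡⟨ cong (λ n → (n × 1#) * D m) ([1+n]Cn≡1+n m) ⟩
        (suc m × 1#) * D m         ≈⟨ [n×1]*x≈n×x (suc m) (D m) ⟩
        suc m × D m                ∎
      fb : f b ≈ D (suc m)
      fb = begin
        f b                                 ≡⟨ cong (λ t → ((suc m C t) × 1#) * D t) toℕ-b ⟩
        ((suc m C suc m) × 1#) * D (suc m)  ≡⟨ cong (λ n → (n × 1#) * D (suc m)) (nCn≡1 (suc m)) ⟩
        (1 × 1#) * D (suc m)                ≈⟨ [n×1]*x≈n×x 1 (D (suc m)) ⟩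
        1 × D (suc m)                       ≈⟨ ×-homo-1 (D (suc m)) ⟩
        D (suc m)                           ∎
      off : ∀ j → j ≢ a → j ≢ b → f j ≈ 0#
      off j j≢a j≢b with ℕ.<-cmp (toℕ j) m
      ... | tri< j<m _ _ with toℕ j ℕ.≟ e
      ...   | yes refl = trans (*-congʳ (C≈0 m m<r j<m)) (zeroˡ _)
      ...   | no  j≢e  = trans (*-congˡ (ih j<m (ℕ.<-trans j<m m<r) j≢e)) (zeroʳ _)
      off j j≢a j≢b | tri≈ _ j≡m _ = contradiction (toℕ≡⇒≡fromℕ< _ j≡m) j≢a
      off j j≢a j≢b | tri> _ _ m<j =
        trans (*-congʳ (≈-reflexive (cong (_× 1#) (k>n⇒nCk≡0 1+m<j)))) (zeroˡ (D (toℕ j)))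
        where
        1+m<j : suc m < toℕ j
        1+m<j = ℕ.≤∧≢⇒< m<j (λ eq → j≢b (toℕ≡⇒≡fromℕ< (s≤s m<r) (≡.sym eq)))
      a≢b : a ≢ b
      a≢b eq = ℕ.<⇒≢ (ℕ.n<1+n m) (≡.trans (≡.sym toℕ-a) (≡.trans (cong toℕ eq) toℕ-b))
      two-terms : suc m × D m + D (suc m) ≈ D (suc m)
      two-terms = begin
        suc m × D m + D (suc m)  ≈⟨ +-cong fa fb ⟨
        f a + f b                ≈⟨ sum-pair f a≢b off ⟨
        sum f                    ≈⟨ recurrence (suc m) m<r ⟩
        D (suc m)                ∎

  module _ {p′} (p-prime : Prime (suc p′)) (char : suc p′ × 1# ≈ 0#) where

    ∣⇒×≈0 : ∀ {n} → suc p′ ∣ n → ∀ x → n × x ≈ 0#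
    ∣⇒×≈0 (divides q refl) x = n×x≈0⇒[m*n]×x≈0 q (suc p′) (n×1≈0⇒n×x≈0 (suc p′) char)

    ∤⇒×-cancel : ∀ {n} → ¬ suc p′ ∣ n → ∀ {x} → n × x ≈ 0# → x ≈ 0#
    ∤⇒×-cancel {n} p∤n {x} n×x≈0 with coprime-Bézout (prime∧∤⇒coprime p-prime p∤n)
    ... | Bézout.+- a b 1+bn≡ap = begin
      x                       ≈⟨ n×x≈0⇒[1+n]×x≈x (b ℕ.* n) (n×x≈0⇒[m*n]×x≈0 b n n×x≈0) ⟨
      suc (b ℕ.* n) × x       ≡⟨ cong (_× x) 1+bn≡ap ⟩
      (a ℕ.* suc p′) × x      ≈⟨ ∣⇒×≈0 (n∣m*n a) x ⟩
      0#                      ∎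
    ... | Bézout.-+ a b 1+ap≡bn = begin
      x                       ≈⟨ n×x≈0⇒[1+n]×x≈x (a ℕ.* suc p′) (∣⇒×≈0 (n∣m*n a) x) ⟨
      suc (a ℕ.* suc p′) × x  ≡⟨ cong (_× x) 1+ap≡bn ⟩
      (b ℕ.* n) × x           ≈⟨ n×x≈0⇒[m*n]×x≈0 b n n×x≈0 ⟩
      0#                      ∎

    unitPascalColumn-p-1 : ∀ {r} → r ≤ 2 ℕ.* p′ → UnitPascalColumn r p′
    unitPascalColumn-p-1 r≤2p′ j j≤r j≢p′ with ℕ.<-cmp j p′
    ... | tri< j<p′ _ _ = ≈-reflexive (cong (_× 1#) (k>n⇒nCk≡0 j<p′))
    ... | tri≈ _ j≡p′ _ = contradiction j≡p′ j≢p′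
    ... | tri> _ _ p′<j = ∣⇒×≈0 (p∣nC[p-1] p-prime p′<j (ℕ.≤-trans j≤r r≤2p′)) 1#

    invariant-support : ∀ {r} → r ≤ 2 ℕ.* p′ → (l : V R r) → Invariant R l →
      ∀ m → m < r → m ≢ p′ → onBasis l m ≈ 0#
    invariant-support {r} r≤2p′ l inv =
      recurrence-vanishing (onBasis l) p′ (shear-recurrence l inv) cancel C≈0
      where
      cancel : ∀ m → m < r → m ≢ p′ → ∀ {x} → suc m × x ≈ 0# → x ≈ 0#
      cancel m m<r m≢p′ = ∤⇒×-cancel (m≢p′ ∘ ℕ.suc-injective ∘ 1+m≡p)
        where
        1+m<2p : suc m < 2 ℕ.* suc p′
        1+m<2p = ℕ.≤-<-trans (ℕ.≤-trans m<r r≤2p′) (ℕ.*-monoʳ-< 2 (ℕ.n<1+n p′))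
        1+m≡p : suc p′ ∣ suc m → suc m ≡ suc p′
        1+m≡p p∣1+m = p∣n<2p⇒n≡p p∣1+m (s≤s z≤n) 1+m<2p
      C≈0 : ∀ m → m < r → p′ < m → (suc m C p′) × 1# ≈ 0#
      C≈0 m m<r p′<m = ∣⇒×≈0 (p∣nC[p-1] p-prime (ℕ.m<n⇒m<1+n p′<m) (ℕ.≤-trans m<r r≤2p′)) 1#

    invariant-support-r<p : ∀ {r} → r ≤ p′ → (l : V R r) → Invariant R l →
      ∀ m → m < r → onBasis l m ≈ 0#
    invariant-support-r<p r≤p′ l inv m m<r =
      invariant-support (ℕ.≤-trans r≤p′ (ℕ.m≤m+n p′ _)) l inv m m<r
                        (ℕ.<⇒≢ (ℕ.<-≤-trans m<r r≤p′))

  module _ {r} (l : V R r) where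
    private
      D : ℕ → Carrier
      D = onBasis l

      top : Fin (suc r)
      top = fromℕ< (ℕ.n<1+n r)

      toℕ-top : toℕ top ≡ r
      toℕ-top = toℕ-fromℕ< (ℕ.n<1+n r)

      below-top : ∀ k → k ≢ top → toℕ k < r
      below-top k k≢top = ℕ.≤∧≢⇒< (ℕ.≤-pred (toℕ<n k)) (k≢top ∘ toℕ≡⇒≡fromℕ< (ℕ.n<1+n r))

    term-as-lam : ∀ {e} (e<1+r : e < suc r) F →
      F (fromℕ< e<1+r) * D e ≈ (sgn R e * D e) * lam R r e F
    term-as-lam {e} e<1+r F = begin
      F E * D e                          ≈⟨ *-comm (F E) (D e) ⟩
      D e * F E                          ≈⟨ *-identityˡ _ ⟨
      1# * (D e * F E)                   ≈⟨ *-congʳ (sgn*sgn≈1 e) ⟨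
      (sgn R e * sgn R e) * (D e * F E)  ≈⟨ interchange (sgn R e) (sgn R e) (D e) (F E) ⟩
      (sgn R e * D e) * (sgn R e * F E)  ≡⟨ cong (sgn R e * D e *_) (lam-fromℕ< F e<1+r) ⟨
      (sgn R e * D e) * lam R r e F      ∎
      where
      E : Fin (suc r)
      E = fromℕ< e<1+r

    spanned-by-lam-r : (∀ m → m < r → D m ≈ 0#) → ∀ F → V.fn l F ≈ (sgn R r * D r) * lam R r r F
    spanned-by-lam-r vanish F = begin
      V.fn l F                       ≈⟨ fn-expand l F ⟩
      sum (λ k → F k * D (toℕ k))    ≈⟨ sum-single _ top off ⟩
      F top * D (toℕ top)            ≡⟨ cong (λ t → F top * D t) toℕ-top ⟩
      F top * D r                    ≈⟨ term-as-lam (ℕ.n<1+n r) F ⟩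
      (sgn R r * D r) * lam R r r F  ∎
      where
      off : ∀ k → k ≢ top → F k * D (toℕ k) ≈ 0#
      off k k≢top = trans (*-congˡ (vanish _ (below-top k k≢top))) (zeroʳ (F k))

    spanned-by-lam-r-lam-e : ∀ {e} → e < r → (∀ m → m < r → m ≢ e → D m ≈ 0#) →
      ∀ F → V.fn l F ≈ (sgn R r * D r) * lam R r r F + (sgn R e * D e) * lam R r e F
    spanned-by-lam-r-lam-e {e} e<r vanish F = begin
      V.fn l F                               ≈⟨ fn-expand l F ⟩
      sum (λ k → F k * D (toℕ k))            ≈⟨ sum-pair _ top≢E off ⟩
      F top * D (toℕ top) + F E * D (toℕ E)
        ≡⟨ cong₂ (λ t u → F top * D t + F E * D u) toℕ-top toℕ-E ⟩
      F top * D r + F E * D e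
        ≈⟨ +-cong (term-as-lam (ℕ.n<1+n r) F) (term-as-lam e<1+r F) ⟩
      (sgn R r * D r) * lam R r r F + (sgn R e * D e) * lam R r e F ∎
      where
      e<1+r : e < suc r
      e<1+r = ℕ.m<n⇒m<1+n e<r
      E : Fin (suc r)
      E = fromℕ< e<1+r
      toℕ-E : toℕ E ≡ e
      toℕ-E = toℕ-fromℕ< e<1+r
      top≢E : top ≢ E
      top≢E eq = ℕ.<⇒≢ e<r (≡.trans (≡.sym toℕ-E) (≡.trans (cong toℕ (≡.sym eq)) toℕ-top))
      off : ∀ k → k ≢ top → k ≢ E → F k * D (toℕ k) ≈ 0#
      off k k≢top k≢E =
        trans (*-congˡ (vanish _ (below-top k k≢top) (k≢E ∘ toℕ≡⇒≡fromℕ< e<1+r))) (zeroʳ (F k))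

open import Data.Nat.Base using (_*_)
open import Data.Product.Base using (_×_)

lemma7p5 : ∀ {c ℓ : Level} (R : CommutativeRing c ℓ) (p r : ℕ) →
    Prime p → HasChar R p → 2 ∣ r →
    (r < p →
      InvariantFn R (lam R r r) ×
      (∀ (l : V R r) → Invariant R l →
        Σ (CommutativeRing.Carrier R) λ x →
          ∀ (F : W R r) →
            CommutativeRing._≈_ R (V.fn l F)
              (CommutativeRing._*_ R x (lam R r r F))))
    ×
    (p ≤ r → r < 2 * p →
      InvariantFn R (lam R r r) × InvariantFn R (lam R r (p ∸ 1)) ×
      (∀ (l : V R r) → Invariant R l →
        Σ (CommutativeRing.Carrier R) λ x → Σ (CommutativeRing.Carrier R) λ y →
          ∀ (F : W R r) →
            CommutativeRing._≈_ R (V.fn l F)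
              (CommutativeRing._+_ R
                (CommutativeRing._*_ R x (lam R r r F))
                (CommutativeRing._*_ R y (lam R r (p ∸ 1) F)))))
lemma7p5 R zero     r p-prime _ _ = contradiction p-prime ¬prime[0]
lemma7p5 R (suc p′) r p-prime (char , _) 2∣r =
  (λ r<p →
     lam-r-invariant ,
     λ l inv → _ , spanned-by-lam-r R l (invariant-support-r<p R p-prime char (ℕ.≤-pred r<p) l inv)) ,
  (λ p≤r r<2p → let r≤2p′ = even<2[1+p]⇒≤2p 2∣r r<2p in
     lam-r-invariant ,
     lam-invariant R 2∣r (ℕ.<⇒≤ p≤r) (unitPascalColumn-p-1 R p-prime char r≤2p′) ,
     λ l inv → _ , _ , spanned-by-lam-r-lam-e R l p≤r (invariant-support R p-prime char r≤2p′ l inv))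
  where
  lam-r-invariant : InvariantFn R (lam R r r)
  lam-r-invariant = lam-invariant R 2∣r ℕ.≤-refl (unitPascalColumn-r R r)
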